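{- Let $k\in\mathbb{N}$, $p$ a prime and $a\in\mathbb{Z}$ with $p\nmid a$, and assume $\left(\frac{a}{p}\right)_{2^{k-1}}=1$. Let $\phi_a$ be the permutation of $\mathbb{Z}_p$ given by $x \bmod p\mapsto ax \bmod p$. Then $\phi_a$ restricts to a permutation of $\mathbb{Z}_{p,2^{k-1}}^*$ and \[ \left(\frac{a}{p}\right)_{2^k}=\operatorname{sgn}\left(\phi_a|_{\mathbb{Z}_{p,2^{k-1}}^*}\right). \]
   Context: For $k\in\mathbb{N}_0$, a prime $p$ and $a\in\mathbb{Z}$ with $p\nmid a$, $\left(\frac{a}{p}\right)_{2^k}=1$ if there is $x\in\mathbb{Z}$ with $x^{2^k}\equiv a \pmod p$, and $-1$ otherwise. $\mathbb{Z}_{p,2^{j}}^*$ denotes the subgroup of $\mathbb{Z}_p^*$ consisting of the $2^j$-th powers of units modulo $p$. No assumption $p\equiv 1\pmod{2^k}$ is made. -}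

module Defs where

open import Data.Nat using (ℕ; zero; suc; _+_; _*_; _^_; _<_; _≤_; _<ᵇ_; NonZero)
open import Data.Nat.Properties using (_<?_; _≟_)
open import Data.Nat.DivMod using (_%_)
open import Data.Nat.Divisibility using () renaming (_∣_ to _∣ℕ_)
open import Data.Integer using (ℤ; +_; -_; _-_) renaming (_*_ to _*ℤ_; _^_ to _^ℤ_)
open import Data.Integer.Divisibility using (_∣_)
open import Data.Integer.DivMod using (_%ℕ_)
open import Data.Bool using (Bool; true; false; if_then_else_; _∧_)
open import Data.List using (List; []; _∷_; filter; upTo; map)
open import Data.Nat.ListAction using (sum)
open import Data.List.Relation.Unary.Any using (any?)
open import Data.Product using (Σ; _×_; ∃)
open import Relation.Binary.PropositionalEquality using (_≡_)
open import Relation.Nullary using (Dec; ¬_)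
open import Relation.Nullary.Decidable using (_×-dec_)

-- (a/p)_n = 1 : there is an integer x with x^n ≡ a (mod p).
-- The power residue symbol (a/p)_n equals 1 iff IsPowerResidue n a p, and -1 otherwise.
IsPowerResidue : ℕ → ℤ → ℕ → Set
IsPowerResidue n a p = ∃ λ (x : ℤ) → (+ p) ∣ ((x ^ℤ n) - a)

-- x (a natural number in [0,p)) is an n-th power of a unit modulo p:
-- 1 ≤ x < p and x ≡ u^n (mod p) for some unit u, 1 ≤ u < p  (p prime, so units = 1..p-1).
IsPowUnit : (n p : ℕ) → .{{NonZero p}} → ℕ → Set
IsPowUnit n p x = (1 ≤ x × x < p) × Data.List.Relation.Unary.Any.Any (λ u → (u ^ n) % p ≡ x) (Data.List.map suc (upTo (Data.Nat.pred p)))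
  where open import Data.List.Relation.Unary.Any

isPowUnit? : (n p : ℕ) → .{{_ : NonZero p}} → (x : ℕ) → Dec (IsPowUnit n p x)
isPowUnit? n p x = ((Data.Nat.Properties._≤?_ 1 x) ×-dec (x <? p)) ×-dec any? (λ u → (u ^ n) % p ≟ x) _

-- Z*_{p,n} : the subgroup of n-th powers of units mod p, listed in increasing order,
-- residues represented by their representatives in [0,p).
PowSubgroup : (n p : ℕ) → .{{NonZero p}} → List ℕ
PowSubgroup n p = filter (isPowUnit? n p) (upTo p)

mulMap : ℤ → (p : ℕ) → .{{NonZero p}} → ℕ → ℕ
mulMap a p x = (a *ℤ (+ x)) %ℕ p

inversions : List ℕ → (ℕ → ℕ) → ℕ
inversions H f = sum (map (λ x → sum (map (λ y → if (x <ᵇ y) ∧ (f y <ᵇ f x) then 1 else 0) H)) H)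

sgn : List ℕ → (ℕ → ℕ) → ℤ
sgn H f = (- (+ 1)) ^ℤ inversions H f

{-# OPTIONS --safe #-}
module Submission where

-- Let n = 2^(k-1), let H be the group of n-th powers of units mod p, of order m, and let b ≡ a,
-- an element of H. Zolotarev's comparison of ∏_{x<y} (b y - b x) with ∏_{x<y} (y - x) shows that
-- the sign of y ↦ b y on H is ≡ b^E (mod p), with E = m(m-1)/2 the number of pairs x < y in H;
-- and (a/p)_{2^k} = 1 exactly when b = r² for some r ∈ H. If so, b^E = r^(m(m-1)) ≡ 1 by Lagrange.
-- If not, y ↦ b/y is a fixed-point-free involution of H, so m = 2q and ∏H ≡ b^q; pairing y with 1/y
-- instead (Wilson) shows that m even forces -1 ∈ H and ∏H ≡ -1. Hence b^q ≡ -1 and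
-- b^E = (b^q)^(2q-1) ≡ -1. For odd p the residues ±1 differ, which pins down the sign; for p = 2,
-- H = {1} and everything is trivial.

module DuplicateFreeLists where

  open import Data.Nat as ℕ using (ℕ; suc; _≤_)
  import Data.Nat.Properties as ℕP
  open import Data.List using (List; []; _∷_; _++_; map; length)
  open import Data.List.Properties using (length-map)
  open import Data.List.Membership.Propositional using (_∈_; _∉_)
  open import Data.List.Membership.Propositional.Properties using (∈-∃++; ∈-map⁻; ∈-++⁻; ∈-++⁺ʳ)
  open import Data.List.Relation.Unary.Any using (here; there)
  open import Data.List.Relation.Unary.All as All using (All; []; _∷_)
  open import Data.List.Relation.Unary.AllPairs using ([]; _∷_)
  open import Data.List.Relation.Unary.Unique.Propositional using (Unique)
  open import Data.List.Relation.Binary.Subset.Propositional using (_⊆_)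
  open import Data.List.Relation.Binary.Permutation.Propositional
    using (_↭_; ↭-refl; ↭-prep; ↭-sym; ↭-trans; ↭⇒↭ₛ)
  open import Data.List.Relation.Binary.Permutation.Propositional.Properties
    using (shift; ∈-resp-↭; ↭-length)
  import Data.List.Relation.Binary.Permutation.Setoid.Properties as ↭ₛ
  open import Data.Product using (∃; _×_; _,_; proj₁; proj₂)
  open import Data.Sum using (inj₁; inj₂)
  open import Data.Empty using (⊥-elim)
  open import Relation.Nullary using (¬_)
  open import Relation.Binary.PropositionalEquality
    using (_≡_; refl; sym; trans; cong; subst; setoid)

  module _ {A : Set} where

    Unique-resp-↭ : {xs ys : List A} → xs ↭ ys → Unique xs → Unique ys
    Unique-resp-↭ σ = ↭ₛ.Unique-resp-↭ (setoid A) (↭⇒↭ₛ σ)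

    ∈⇒↭∷ : {x : A} {xs : List A} → x ∈ xs → ∃ λ ys → xs ↭ x ∷ ys
    ∈⇒↭∷ {x} x∈xs with ys , zs , refl ← ∈-∃++ x∈xs = ys ++ zs , shift x ys zs

    ∈-∷⁻ : {x y : A} {xs : List A} → y ∈ x ∷ xs → ¬ y ≡ x → y ∈ xs
    ∈-∷⁻ (here y≡x) y≢x = ⊥-elim (y≢x y≡x)
    ∈-∷⁻ (there y∈xs) _ = y∈xs

    All≢⇒∉ : {x : A} {xs : List A} → All (λ y → ¬ x ≡ y) xs → x ∉ xs
    All≢⇒∉ (x≢y ∷ _) (here refl) = x≢y refl
    All≢⇒∉ (_ ∷ x≢ys) (there x∈ys) = All≢⇒∉ x≢ys x∈ys

    Unique-map⁺ : (f : A → A) {xs : List A} →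
      (∀ {x y} → x ∈ xs → y ∈ xs → f x ≡ f y → x ≡ y) → Unique xs → Unique (map f xs)
    Unique-map⁺ f {[]} _ [] = []
    Unique-map⁺ f {x ∷ xs} inj (x∉xs ∷ u) =
      All.tabulate fx≢ ∷ Unique-map⁺ f (λ x∈ y∈ → inj (there x∈) (there y∈)) u
      where
      fx≢ : ∀ {z} → z ∈ map f xs → ¬ f x ≡ z
      fx≢ z∈ fx≡z with y , y∈xs , refl ← ∈-map⁻ f z∈ =
        All≢⇒∉ x∉xs (subst (_∈ xs) (sym (inj (here refl) (there y∈xs) fx≡z)) y∈xs)

    ⊆∧length≤⇒↭ : (xs ys : List A) → Unique xs → Unique ys → xs ⊆ ys →
      length ys ≤ length xs → xs ↭ ys
    ⊆∧length≤⇒↭ [] [] _ _ _ _ = ↭-refl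
    ⊆∧length≤⇒↭ (x ∷ xs) ys (x∉xs ∷ uxs) uys xs⊆ys len≤
      with ys′ , σ ← ∈⇒↭∷ (xs⊆ys (here refl))
      with _ ∷ uys′ ← Unique-resp-↭ σ uys =
      ↭-trans (↭-prep x (⊆∧length≤⇒↭ xs ys′ uxs uys′ xs⊆ys′ len≤′)) (↭-sym σ)
      where
      xs⊆ys′ : xs ⊆ ys′
      xs⊆ys′ z∈xs with ∈-resp-↭ σ (xs⊆ys (there z∈xs))
      ... | here refl = ⊥-elim (All≢⇒∉ x∉xs z∈xs)
      ... | there z∈ys′ = z∈ys′
      len≤′ : length ys′ ≤ length xs
      len≤′ = ℕP.≤-pred (subst (_≤ suc (length xs)) (↭-length σ) len≤)

    injectiveOn⇒map↭ : (f : A → A) {xs : List A} → Unique xs →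
      (∀ {x} → x ∈ xs → f x ∈ xs) →
      (∀ {x y} → x ∈ xs → y ∈ xs → f x ≡ f y → x ≡ y) → map f xs ↭ xs
    injectiveOn⇒map↭ f {xs} u into inj =
      ⊆∧length≤⇒↭ (map f xs) xs (Unique-map⁺ f inj u) u image⊆ (ℕP.≤-reflexive (sym (length-map f xs)))
      where
      image⊆ : map f xs ⊆ xs
      image⊆ z∈ with y , y∈xs , refl ← ∈-map⁻ f z∈ = into y∈xs

    Unique-++⇒∉ : (ds : List A) {ys : List A} {x : A} → Unique (ds ++ ys) → x ∈ ds → x ∉ ys
    Unique-++⇒∉ (d ∷ ds) (d∉ ∷ _) (here refl) x∈ys = All≢⇒∉ d∉ (∈-++⁺ʳ ds x∈ys)
    Unique-++⇒∉ (d ∷ ds) (_ ∷ u) (there x∈ds) = Unique-++⇒∉ ds u x∈ds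

    Unique-++⁻ʳ : (ds : List A) {ys : List A} → Unique (ds ++ ys) → Unique ys
    Unique-++⁻ʳ [] u = u
    Unique-++⁻ʳ (d ∷ ds) (_ ∷ u) = Unique-++⁻ʳ ds u

    record IsInvolutionOn (ι : A → A) (xs : List A) : Set where
      field
        ∈-closed : ∀ {x} → x ∈ xs → ι x ∈ xs
        involutive : ∀ {x} → x ∈ xs → ι (ι x) ≡ x

    open IsInvolutionOn

    IsInvolutionOn-resp-↭ : {ι : A → A} {xs ys : List A} → xs ↭ ys →
      IsInvolutionOn ι xs → IsInvolutionOn ι ys
    IsInvolutionOn-resp-↭ σ inv = record
      { ∈-closed = λ x∈ → ∈-resp-↭ σ (∈-closed inv (∈-resp-↭ (↭-sym σ) x∈))
      ; involutive = λ x∈ → involutive inv (∈-resp-↭ (↭-sym σ) x∈) }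

    IsInvolutionOn-++⁻ʳ : {ι : A → A} (ds : List A) {ys : List A} → Unique (ds ++ ys) →
      (∀ {d} → d ∈ ds → ι d ∈ ds) → IsInvolutionOn ι (ds ++ ys) → IsInvolutionOn ι ys
    IsInvolutionOn-++⁻ʳ {ι} ds {ys} u ds-closed inv = record
      { ∈-closed = ys-closed ; involutive = λ y∈ → involutive inv (∈-++⁺ʳ ds y∈) }
      where
      ys-closed : ∀ {y} → y ∈ ys → ι y ∈ ys
      ys-closed {y} y∈ with ∈-++⁻ ds (∈-closed inv (∈-++⁺ʳ ds y∈))
      ... | inj₂ ιy∈ys = ιy∈ys
      ... | inj₁ ιy∈ds = ⊥-elim (Unique-++⇒∉ ds u
              (subst (_∈ ds) (involutive inv (∈-++⁺ʳ ds y∈)) (ds-closed ιy∈ds)) y∈)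

    pairUp : (A → A) → List A → List A
    pairUp ι [] = []
    pairUp ι (x ∷ xs) = x ∷ ι x ∷ pairUp ι xs

    length-pairUp : (ι : A → A) (xs : List A) → length (pairUp ι xs) ≡ length xs ℕ.+ length xs
    length-pairUp ι [] = refl
    length-pairUp ι (x ∷ xs) = cong suc (trans (cong suc (length-pairUp ι xs)) (sym (ℕP.+-suc _ _)))

    fixedPointFree⇒↭pairUp : (ι : A → A) (xs : List A) → Unique xs → IsInvolutionOn ι xs →
      (∀ {x} → x ∈ xs → ¬ ι x ≡ x) → ∃ λ rs → rs ⊆ xs × xs ↭ pairUp ι rs
    fixedPointFree⇒↭pairUp ι xs = go (length xs) xs ℕP.≤-refl
      where
      go : ∀ fuel xs → length xs ≤ fuel → Unique xs → IsInvolutionOn ι xs →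
        (∀ {x} → x ∈ xs → ¬ ι x ≡ x) → ∃ λ rs → rs ⊆ xs × xs ↭ pairUp ι rs
      go _ [] _ _ _ _ = [] , (λ ()) , ↭-refl
      go (suc fuel) (x ∷ xs) (ℕ.s≤s len≤) u inv nofix =
        x ∷ rs , rs⊆ , ↭-trans ρ (↭-prep x (↭-prep (ι x) τ))
        where
        ιx∈xs : ι x ∈ xs
        ιx∈xs with ∈-closed inv (here refl)
        ... | here ιx≡x = ⊥-elim (nofix (here refl) ιx≡x)
        ... | there ιx∈xs = ιx∈xs
        ys : List A
        ys = proj₁ (∈⇒↭∷ ιx∈xs)
        σ : xs ↭ ι x ∷ ys
        σ = proj₂ (∈⇒↭∷ ιx∈xs)
        ρ : x ∷ xs ↭ (x ∷ ι x ∷ []) ++ ys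
        ρ = ↭-prep x σ
        ys⊆ : ys ⊆ x ∷ xs
        ys⊆ y∈ = ∈-resp-↭ (↭-sym ρ) (there (there y∈))
        ys-length : length ys ≤ fuel
        ys-length = ℕP.≤-trans (ℕP.n≤1+n _) (subst (_≤ fuel) (↭-length σ) len≤)
        ys-unique : Unique ys
        ys-unique with _ ∷ _ ∷ u′ ← Unique-resp-↭ ρ u = u′
        pair-closed : ∀ {d} → d ∈ x ∷ ι x ∷ [] → ι d ∈ x ∷ ι x ∷ []
        pair-closed (here refl) = there (here refl)
        pair-closed (there (here refl)) = here (involutive inv (here refl))
        ys-involution : IsInvolutionOn ι ys
        ys-involution = IsInvolutionOn-++⁻ʳ (x ∷ ι x ∷ []) (Unique-resp-↭ ρ u) pair-closed
          (IsInvolutionOn-resp-↭ ρ inv)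
        rec : ∃ λ rs → rs ⊆ ys × ys ↭ pairUp ι rs
        rec = go fuel ys ys-length ys-unique ys-involution (λ y∈ → nofix (ys⊆ y∈))
        rs : List A
        rs = proj₁ rec
        τ : ys ↭ pairUp ι rs
        τ = proj₂ (proj₂ rec)
        rs⊆ : x ∷ rs ⊆ x ∷ xs
        rs⊆ (here refl) = here refl
        rs⊆ (there r∈) = ys⊆ (proj₁ (proj₂ rec) r∈)

module BigOperators where

  open import Algebra.Bundles using (CommutativeMonoid)
  import Algebra.Properties.CommutativeSemigroup as CommutativeSemigroupProperties
  open import Data.List using (List; []; _∷_; map; foldr)
  open import Data.List.Properties using (map-∘)
  open import Data.List.Membership.Propositional using (_∈_)
  open import Data.List.Relation.Unary.Any using (here; there)
  open import Data.List.Relation.Binary.Permutation.Propositional using (_↭_; ↭⇒↭ₛ′)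
  open import Data.List.Relation.Binary.Permutation.Propositional.Properties using () renaming (map⁺ to ↭-map⁺)
  import Data.List.Relation.Binary.Permutation.Setoid.Properties as ↭ₛ
  open import Function using (_∘_)
  open import Relation.Binary.PropositionalEquality as ≡ using (_≡_)
  open DuplicateFreeLists using (pairUp)

  module BigOperator {c ℓ} (M : CommutativeMonoid c ℓ) where

    open CommutativeMonoid M
    open CommutativeSemigroupProperties commutativeSemigroup using (interchange)
    open import Relation.Binary.Reasoning.Setoid setoid

    ∏ : {A : Set} → List A → (A → Carrier) → Carrier
    ∏ xs f = foldr _∙_ ε (map f xs)

    ∏-cong : {A : Set} (xs : List A) {f g : A → Carrier} → (∀ {x} → x ∈ xs → f x ≈ g x) → ∏ xs f ≈ ∏ xs g
    ∏-cong [] _ = refl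
    ∏-cong (x ∷ xs) f≈g = ∙-cong (f≈g (here ≡.refl)) (∏-cong xs (f≈g ∘ there))

    ∏-ε : {A : Set} (xs : List A) → ∏ xs (λ _ → ε) ≈ ε
    ∏-ε [] = refl
    ∏-ε (x ∷ xs) = trans (identityˡ _) (∏-ε xs)

    ∏-∙ : {A : Set} (xs : List A) (f g : A → Carrier) → ∏ xs (λ x → f x ∙ g x) ≈ ∏ xs f ∙ ∏ xs g
    ∏-∙ [] f g = sym (identityˡ ε)
    ∏-∙ (x ∷ xs) f g = begin
      (f x ∙ g x) ∙ ∏ xs (λ x → f x ∙ g x) ≈⟨ ∙-congˡ (∏-∙ xs f g) ⟩
      (f x ∙ g x) ∙ (∏ xs f ∙ ∏ xs g)       ≈⟨ interchange (f x) (g x) _ _ ⟩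
      (f x ∙ ∏ xs f) ∙ (g x ∙ ∏ xs g)       ∎

    ∏-swap : {A B : Set} (xs : List A) (ys : List B) (F : A → B → Carrier) →
      ∏ xs (λ x → ∏ ys (F x)) ≈ ∏ ys (λ y → ∏ xs (λ x → F x y))
    ∏-swap [] ys F = sym (∏-ε ys)
    ∏-swap (x ∷ xs) ys F = begin
      ∏ ys (F x) ∙ ∏ xs (λ x → ∏ ys (F x))            ≈⟨ ∙-congˡ (∏-swap xs ys F) ⟩
      ∏ ys (F x) ∙ ∏ ys (λ y → ∏ xs (λ x → F x y))    ≈⟨ sym (∏-∙ ys (F x) _) ⟩
      ∏ ys (λ y → F x y ∙ ∏ xs (λ x → F x y))         ∎

    ∏-map : {A B : Set} (g : B → A) (xs : List B) (f : A → Carrier) → ∏ (map g xs) f ≡ ∏ xs (f ∘ g)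
    ∏-map g xs f = ≡.cong (foldr _∙_ ε) (≡.sym (map-∘ xs))

    ∏-↭ : {A : Set} {xs ys : List A} (f : A → Carrier) → xs ↭ ys → ∏ xs f ≈ ∏ ys f
    ∏-↭ f σ = ↭ₛ.foldr-commMonoid setoid isCommutativeMonoid (↭⇒↭ₛ′ isEquivalence (↭-map⁺ f σ))

    ∏-pairUp : {A : Set} (ι : A → A) (xs : List A) (f : A → Carrier) →
      ∏ (pairUp ι xs) f ≈ ∏ xs (λ x → f x ∙ f (ι x))
    ∏-pairUp ι [] f = refl
    ∏-pairUp ι (x ∷ xs) f = trans (sym (assoc _ _ _)) (∙-congˡ (∏-pairUp ι xs f))

module Congruence where

  open import Data.Nat as ℕ using (ℕ; zero; suc; NonZero; z≤n; s≤s)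
  import Data.Nat.Properties as ℕP
  import Data.Nat.Divisibility as ℕD
  open import Data.Nat.Primality using (Prime; euclidsLemma; prime⇒nonZero; prime⇒nonTrivial)
  open import Data.Integer using (ℤ; +_; -_; _+_; _-_; _*_; _^_; ∣_∣)
  import Data.Integer.Properties as ℤP
  open import Data.Integer.DivMod using (_%ℕ_; _/ℕ_; a≡a%ℕn+[a/ℕn]*n)
  open import Data.Integer.Divisibility.Signed
    using (_∣_; divides; ∣ᵤ⇒∣; ∣⇒∣ᵤ; ∣m∣n⇒∣m+n; ∣m⇒∣-m; ∣n⇒∣m*n; ∣m⇒∣m*n)
  open import Data.Integer.Tactic.RingSolver using (solve-∀)
  open import Data.Sum using (_⊎_; inj₁; inj₂)
  open import Data.Empty using (⊥-elim)
  open import Relation.Nullary using (¬_)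
  open import Relation.Binary.Bundles using (Setoid)
  open import Algebra.Bundles using (CommutativeMonoid)
  open import Data.List using (List; []; _∷_; length)
  open import Data.List.Membership.Propositional using (_∈_)
  open import Data.List.Relation.Unary.Any using (here; there)
  open import Data.Product using (_,_)
  open BigOperators using (module BigOperator)
  open import Relation.Binary.PropositionalEquality
    using (_≡_; refl; sym; trans; cong; cong₂; subst)

  pos-^ : ∀ m n → + (m ℕ.^ n) ≡ (+ m) ^ n
  pos-^ m zero = refl
  pos-^ m (suc n) = trans (ℤP.pos-* m (m ℕ.^ n)) (cong (+ m *_) (pos-^ m n))

  ^-distribʳ-* : ∀ x y n → (x * y) ^ n ≡ x ^ n * y ^ n
  ^-distribʳ-* x y zero = refl
  ^-distribʳ-* x y (suc n) = trans (cong (x * y *_) (^-distribʳ-* x y n)) (lemma x y (x ^ n) (y ^ n))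
    where
    lemma : ∀ x y a b → x * y * (a * b) ≡ x * a * (y * b)
    lemma = solve-∀

  pos-∸ : ∀ {m n} → n ℕ.≤ m → + (m ℕ.∸ n) ≡ + m - + n
  pos-∸ {m} {n} n≤m = sym (trans (ℤP.m-n≡m⊖n m n) (ℤP.⊖-≥ n≤m))

  -1^≡±1 : ∀ k → (- + 1) ^ k ≡ + 1 ⊎ (- + 1) ^ k ≡ - + 1
  -1^≡±1 zero = inj₁ refl
  -1^≡±1 (suc k) with -1^≡±1 k
  ... | inj₁ e = inj₂ (cong (- + 1 *_) e)
  ... | inj₂ e = inj₁ (cong (- + 1 *_) e)

  -1^[k+k]≡1 : ∀ k → (- + 1) ^ (k ℕ.+ k) ≡ + 1
  -1^[k+k]≡1 k with -1^≡±1 k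
  ... | inj₁ e = trans (ℤP.^-distribˡ-+-* _ k k) (cong₂ _*_ e e)
  ... | inj₂ e = trans (ℤP.^-distribˡ-+-* _ k k) (cong₂ _*_ e e)

  module Modulo (p : ℕ) (pr : Prime p) where

    instance
      p-nonZero : NonZero p
      p-nonZero = prime⇒nonZero pr

    1<p : 1 ℕ.< p
    1<p = ℕ.nonTrivial⇒n>1 p {{prime⇒nonTrivial pr}}

    infix 4 _≋_
    record _≋_ (x y : ℤ) : Set where
      constructor mk
      field get : + p ∣ x - y
    open _≋_ public

    private
      ∣-by : ∀ {x y} → x ≡ y → + p ∣ x → + p ∣ y
      ∣-by refl d = d

    ≋-refl : ∀ {x} → x ≋ x
    ≋-refl {x} = mk (divides (+ 0) (ℤP.+-inverseʳ x))

    ≋-reflexive : ∀ {x y} → x ≡ y → x ≋ y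
    ≋-reflexive refl = ≋-refl

    ≋-sym : ∀ {x y} → x ≋ y → y ≋ x
    ≋-sym {x} {y} (mk d) = mk (∣-by (lemma x y) (∣m⇒∣-m d))
      where
      lemma : ∀ x y → - (x - y) ≡ y - x
      lemma = solve-∀

    ≋-trans : ∀ {x y z} → x ≋ y → y ≋ z → x ≋ z
    ≋-trans {x} {y} {z} (mk d) (mk e) = mk (∣-by (lemma x y z) (∣m∣n⇒∣m+n d e))
      where
      lemma : ∀ x y z → (x - y) + (y - z) ≡ x - z
      lemma = solve-∀

    ≋-setoid : Setoid _ _
    ≋-setoid = record
      { Carrier = ℤ ; _≈_ = _≋_
      ; isEquivalence = record { refl = ≋-refl ; sym = ≋-sym ; trans = ≋-trans } }

    ≋-- : ∀ {x y u v} → x ≋ y → u ≋ v → x - u ≋ y - v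
    ≋-- {x} {y} {u} {v} (mk d) (mk e) = mk (∣-by (lemma x y u v) (∣m∣n⇒∣m+n d (∣m⇒∣-m e)))
      where
      lemma : ∀ x y u v → (x - y) + - (u - v) ≡ (x - u) - (y - v)
      lemma = solve-∀

    ≋-* : ∀ {x y u v} → x ≋ y → u ≋ v → x * u ≋ y * v
    ≋-* {x} {y} {u} {v} (mk d) (mk e) =
      mk (∣-by (lemma x y u v) (∣m∣n⇒∣m+n (∣n⇒∣m*n x e) (∣m⇒∣m*n v d)))
      where
      lemma : ∀ x y u v → x * (u - v) + (x - y) * v ≡ x * u - y * v
      lemma = solve-∀

    ≋-^ : ∀ {x y} n → x ≋ y → x ^ n ≋ y ^ n
    ≋-^ zero _ = ≋-refl
    ≋-^ (suc n) x≋y = ≋-* x≋y (≋-^ n x≋y)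

    +-multiple-≋ : ∀ x q → x + q * + p ≋ x
    +-multiple-≋ x q = mk (divides q (lemma x q (+ p)))
      where
      lemma : ∀ x q p → x + q * p - x ≡ q * p
      lemma = solve-∀

    %ℕ-≋ : ∀ z → + (z %ℕ p) ≋ z
    %ℕ-≋ z = ≋-sym (subst (_≋ + (z %ℕ p)) (sym (a≡a%ℕn+[a/ℕn]*n z p)) (+-multiple-≋ _ (z /ℕ p)))

    private
      multiple<p⇒≡0 : ∀ {n} → n ℕ.< p → + p ∣ + n → n ≡ 0
      multiple<p⇒≡0 {zero} _ _ = refl
      multiple<p⇒≡0 {suc n} n<p d = ⊥-elim (ℕP.<⇒≱ n<p (ℕD.∣⇒≤ (∣⇒∣ᵤ d)))

      ≋∧≤⇒≡ : ∀ {y z} → z ℕ.≤ y → y ℕ.< p → + y ≋ + z → y ≡ z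
      ≋∧≤⇒≡ {y} {z} z≤y y<p (mk d) = ℕP.≤-antisym (ℕP.m∸n≡0⇒m≤n y∸z≡0) z≤y
        where
        y∸z≡0 : y ℕ.∸ z ≡ 0
        y∸z≡0 = multiple<p⇒≡0 (ℕP.≤-<-trans (ℕP.m∸n≤m y z) y<p)
          (∣-by (sym (pos-∸ z≤y)) d)

    ≋⇒≡ : ∀ {y z} → y ℕ.< p → z ℕ.< p → + y ≋ + z → y ≡ z
    ≋⇒≡ {y} {z} y<p z<p y≋z with ℕP.≤-total z y
    ... | inj₁ z≤y = ≋∧≤⇒≡ z≤y y<p y≋z
    ... | inj₂ y≤z = sym (≋∧≤⇒≡ y≤z z<p (≋-sym y≋z))

    Unit : ℤ → Set
    Unit x = ¬ (+ p ∣ x)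

    euclid : ∀ x y → + p ∣ x * y → (+ p ∣ x) ⊎ (+ p ∣ y)
    euclid x y d with euclidsLemma ∣ x ∣ ∣ y ∣ pr (subst (p ℕD.∣_) (ℤP.abs-* x y) (∣⇒∣ᵤ d))
    ... | inj₁ p∣x = inj₁ (∣ᵤ⇒∣ p∣x)
    ... | inj₂ p∣y = inj₂ (∣ᵤ⇒∣ p∣y)

    Unit-* : ∀ {x y} → Unit x → Unit y → Unit (x * y)
    Unit-* {x} {y} ux uy d with euclid x y d
    ... | inj₁ p∣x = ux p∣x
    ... | inj₂ p∣y = uy p∣y

    Unit-pos : ∀ {y} → 1 ℕ.≤ y → y ℕ.< p → Unit (+ y)
    Unit-pos {suc y} _ y<p d = ℕP.<⇒≱ y<p (ℕD.∣⇒≤ (∣⇒∣ᵤ d))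

    Unit⇒1≤ : ∀ {y} → Unit (+ y) → 1 ℕ.≤ y
    Unit⇒1≤ {zero} u = ⊥-elim (u (divides (+ 0) refl))
    Unit⇒1≤ {suc y} _ = s≤s z≤n

    Unit-1 : Unit (+ 1)
    Unit-1 = Unit-pos ℕP.≤-refl 1<p

    Unit-^ : ∀ {x} n → Unit x → Unit (x ^ n)
    Unit-^ zero _ = Unit-1
    Unit-^ (suc n) ux = Unit-* ux (Unit-^ n ux)

    Unit-^⁻ : ∀ {x} n .{{_ : NonZero n}} → Unit (x ^ n) → Unit x
    Unit-^⁻ {x} (suc n) u d = u (∣m⇒∣m*n (x ^ n) d)

    Unit-resp-≋ : ∀ {x y} → x ≋ y → Unit x → Unit y
    Unit-resp-≋ {x} {y} (mk d) ux p∣y = ux (∣-by (lemma x y) (∣m∣n⇒∣m+n d p∣y))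
      where
      lemma : ∀ x y → (x - y) + y ≡ x
      lemma = solve-∀

    *-cancelˡ-≋ : ∀ {c x y} → Unit c → c * x ≋ c * y → x ≋ y
    *-cancelˡ-≋ {c} {x} {y} uc (mk d) with euclid c (x - y) (∣-by (lemma c x y) d)
      where
      lemma : ∀ c x y → c * x - c * y ≡ c * (x - y)
      lemma = solve-∀
    ... | inj₁ p∣c = ⊥-elim (uc p∣c)
    ... | inj₂ p∣x-y = mk p∣x-y

    p-1≋-1 : + (p ℕ.∸ 1) ≋ - + 1
    p-1≋-1 = mk (divides (+ 1) (trans (cong (_- - + 1) (pos-∸ (ℕP.<⇒≤ 1<p))) (lemma (+ p))))
      where
      lemma : ∀ p → p - + 1 - - + 1 ≡ + 1 * p
      lemma = solve-∀

    p-1<p : p ℕ.∸ 1 ℕ.< p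
    p-1<p = ℕP.∸-monoʳ-< {p} {1} {0} ℕP.≤-refl (ℕP.<⇒≤ 1<p)

    square≋1⇒≡±1 : ∀ {x} → x ℕ.< p → + x * + x ≋ + 1 → x ≡ 1 ⊎ x ≡ p ℕ.∸ 1
    square≋1⇒≡±1 {x} x<p (mk d) with euclid (+ x - + 1) (+ x + + 1) (∣-by (factor (+ x)) d)
      where
      factor : ∀ x → x * x - + 1 ≡ (x - + 1) * (x + + 1)
      factor = solve-∀
    ... | inj₁ p∣x-1 = inj₁ (≋⇒≡ x<p 1<p (mk p∣x-1))
    ... | inj₂ p∣x+1 = inj₂ (≋⇒≡ x<p p-1<p (≋-trans (mk (∣-by (lemma (+ x)) p∣x+1)) (≋-sym p-1≋-1)))
      where
      lemma : ∀ x → x + + 1 ≡ x - - + 1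
      lemma = solve-∀

    1≉-1 : ¬ p ≡ 2 → ¬ (+ 1 ≋ - + 1)
    1≉-1 p≢2 (mk d) with multiple<p⇒≡0 {2} (ℕP.≤∧≢⇒< 1<p (λ 2≡p → p≢2 (sym 2≡p))) d
    ... | ()

    ≋-*-commutativeMonoid : CommutativeMonoid _ _
    ≋-*-commutativeMonoid = record
      { Carrier = ℤ ; _≈_ = _≋_ ; _∙_ = _*_ ; ε = + 1
      ; isCommutativeMonoid = record
        { isMonoid = record
          { isSemigroup = record
            { isMagma = record { isEquivalence = Setoid.isEquivalence ≋-setoid ; ∙-cong = ≋-* }
            ; assoc = λ x y z → ≋-reflexive (ℤP.*-assoc x y z) }
          ; identity = (λ x → ≋-reflexive (ℤP.*-identityˡ x)) , (λ x → ≋-reflexive (ℤP.*-identityʳ x)) }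
        ; comm = λ x y → ≋-reflexive (ℤP.*-comm x y) } }

    module ℤ*ₚ = BigOperator ≋-*-commutativeMonoid

    Unit-∏ : {A : Set} (xs : List A) {f : A → ℤ} → (∀ {x} → x ∈ xs → Unit (f x)) → Unit (ℤ*ₚ.∏ xs f)
    Unit-∏ [] _ = Unit-1
    Unit-∏ (x ∷ xs) u = Unit-* (u (here refl)) (Unit-∏ xs (λ x∈ → u (there x∈)))

    ∏-const : {A : Set} (xs : List A) (c : ℤ) → ℤ*ₚ.∏ xs (λ _ → c) ≡ c ^ length xs
    ∏-const [] c = refl
    ∏-const (x ∷ xs) c = cong (c *_) (∏-const xs c)

    -1^≋⇒≡ : ¬ p ≡ 2 → ∀ k {ε} → (ε ≡ + 1 ⊎ ε ≡ - + 1) → (- + 1) ^ k ≋ ε → (- + 1) ^ k ≡ ε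
    -1^≋⇒≡ p≢2 k ε≡±1 -1ᵏ≋ε with -1^≡±1 k | ε≡±1
    ... | inj₁ e | inj₁ refl = e
    ... | inj₂ e | inj₂ refl = e
    ... | inj₁ e | inj₂ refl = ⊥-elim (1≉-1 p≢2 (≋-trans (≋-reflexive (sym e)) -1ᵏ≋ε))
    ... | inj₂ e | inj₁ refl = ⊥-elim (1≉-1 p≢2 (≋-sym (≋-trans (≋-reflexive (sym e)) -1ᵏ≋ε)))

module PowerSubgroups where

  open import Defs using (PowSubgroup; isPowUnit?)
  open import Data.Nat as ℕ using (ℕ; zero; suc; z≤n; s≤s)
  import Data.Nat.Properties as ℕP
  open import Data.Nat.DivMod using (_%_; m%n<n)
  open import Data.Nat.Primality using (Prime)
  open import Data.Integer using (ℤ; +_; -_; _*_; _^_)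
  import Data.Integer.Properties as ℤP
  open import Data.Integer.Tactic.RingSolver using (solve-∀)
  open import Data.List using (List; []; _∷_; _++_; map; length; upTo)
  open import Data.List.Membership.Propositional using (_∈_; _∉_; lose; find)
  open import Data.List.Relation.Unary.Any using (here; there)
  open import Data.List.Membership.Propositional.Properties
    using (∈-map⁺; ∈-map⁻; ∈-upTo⁺; ∈-upTo⁻; ∈-filter⁺; ∈-filter⁻; ∈-++⁺ʳ)
  open import Data.List.Relation.Unary.Unique.Propositional using (Unique)
  open import Data.List.Relation.Unary.Unique.Propositional.Properties using (upTo⁺; filter⁺)
  open import Data.List.Relation.Binary.Permutation.Propositional using (_↭_; ↭-sym; ↭-trans; ↭-prep)
  open import Data.List.Relation.Binary.Permutation.Propositional.Properties using (∈-resp-↭; ↭-length)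
  open import Data.List.Relation.Binary.Subset.Propositional using (_⊆_)
  open import Data.Sum using (_⊎_; [_,_]′)
  open import Function using (_∘_)
  open import Data.Product using (∃; _×_; _,_; proj₁; proj₂)
  open import Data.Empty using (⊥-elim)
  open import Relation.Nullary using (¬_)
  open import Relation.Binary.PropositionalEquality using (_≡_; refl; sym; trans; cong; subst)
  open DuplicateFreeLists
    using ( Unique-resp-↭; ∈⇒↭∷; ∈-∷⁻; Unique-++⁻ʳ; Unique-++⇒∉; injectiveOn⇒map↭; IsInvolutionOn
          ; IsInvolutionOn-resp-↭; IsInvolutionOn-++⁻ʳ; pairUp; length-pairUp; fixedPointFree⇒↭pairUp)
  open Congruence

  ∈-units : ∀ {q v} → 1 ℕ.≤ v → v ℕ.< q → v ∈ map suc (upTo (ℕ.pred q))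
  ∈-units {suc q} {suc w} _ (s≤s w<q) = ∈-map⁺ suc (∈-upTo⁺ w<q)

  module PowerSubgroup (p : ℕ) (pr : Prime p) (n : ℕ) where

    open Modulo p pr public
    open import Relation.Binary.Reasoning.Setoid ≋-setoid

    H : List ℕ
    H = PowSubgroup n p

    m : ℕ
    m = length H

    H-unique : Unique H
    H-unique = filter⁺ (isPowUnit? n p) (upTo⁺ p)

    IsPowerOfUnit : ℕ → Set
    IsPowerOfUnit y = ∃ λ u → Unit (+ u) × + y ≋ (+ u) ^ n

    %-≋ : ∀ x → + (x % p) ≋ + x
    %-≋ x = %ℕ-≋ (+ x)

    ^%-≋ : ∀ x j → + ((x ℕ.^ j) % p) ≋ (+ x) ^ j
    ^%-≋ x j = ≋-trans (%-≋ _) (≋-reflexive (pos-^ x j))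

    ∈H⁺ : ∀ {y} → y ℕ.< p → IsPowerOfUnit y → y ∈ H
    ∈H⁺ {y} y<p (u , u-unit , y≋uⁿ) =
      ∈-filter⁺ (isPowUnit? n p) (∈-upTo⁺ y<p) ((Unit⇒1≤ y-unit , y<p) , lose r∈units rⁿ%p≡y)
      where
      y-unit : Unit (+ y)
      y-unit = Unit-resp-≋ (≋-sym y≋uⁿ) (Unit-^ n u-unit)
      r : ℕ
      r = u % p
      r-unit : Unit (+ r)
      r-unit = Unit-resp-≋ (≋-sym (%-≋ u)) u-unit
      r∈units : r ∈ map suc (upTo (ℕ.pred p))
      r∈units = ∈-units (Unit⇒1≤ r-unit) (m%n<n u p)
      rⁿ%p≡y : (r ℕ.^ n) % p ≡ y
      rⁿ%p≡y = ≋⇒≡ (m%n<n _ p) y<p (begin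
        + ((r ℕ.^ n) % p) ≈⟨ ^%-≋ r n ⟩
        (+ r) ^ n         ≈⟨ ≋-^ n (%-≋ u) ⟩
        (+ u) ^ n         ≈⟨ ≋-sym y≋uⁿ ⟩
        + y               ∎)

    ∈H⁻ : ∀ {y} → y ∈ H → y ℕ.< p × IsPowerOfUnit y
    ∈H⁻ {y} y∈H with ∈-filter⁻ (isPowUnit? n p) {xs = upTo p} y∈H
    ... | _ , (_ , y<p) , is-power with find is-power
    ... | u , u∈units , uⁿ%p≡y with w , w∈ , refl ← ∈-map⁻ suc u∈units =
      y<p , u , Unit-pos (s≤s z≤n) (<-suc (∈-upTo⁻ w∈)) ,
      ≋-trans (≋-reflexive (cong +_ (sym uⁿ%p≡y))) (^%-≋ u n)
      where
      <-suc : ∀ {q} .{{_ : ℕ.NonZero q}} → w ℕ.< ℕ.pred q → suc w ℕ.< q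
      <-suc {suc q} w<q = s≤s w<q

    ∈H⇒<p : ∀ {y} → y ∈ H → y ℕ.< p
    ∈H⇒<p y∈H = proj₁ (∈H⁻ y∈H)

    ∈H⇒Unit : ∀ {y} → y ∈ H → Unit (+ y)
    ∈H⇒Unit y∈H with _ , u , u-unit , y≋uⁿ ← ∈H⁻ y∈H = Unit-resp-≋ (≋-sym y≋uⁿ) (Unit-^ n u-unit)

    1∈H : 1 ∈ H
    1∈H = ∈H⁺ 1<p (1 , Unit-1 , ≋-reflexive (sym (ℤP.^-zeroˡ n)))

    ∈H-* : ∀ {x y z} → x ∈ H → y ∈ H → z ℕ.< p → + z ≋ + x * + y → z ∈ H
    ∈H-* {x} {y} {z} x∈H y∈H z<p z≋xy
      with _ , u , u-unit , x≋uⁿ ← ∈H⁻ x∈H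
      with _ , v , v-unit , y≋vⁿ ← ∈H⁻ y∈H =
      ∈H⁺ z<p (u ℕ.* v , subst Unit (sym (ℤP.pos-* u v)) (Unit-* u-unit v-unit) , (begin
        + z                  ≈⟨ z≋xy ⟩
        + x * + y            ≈⟨ ≋-* x≋uⁿ y≋vⁿ ⟩
        (+ u) ^ n * (+ v) ^ n ≡⟨ sym (^-distribʳ-* (+ u) (+ v) n) ⟩
        (+ u * + v) ^ n      ≡⟨ cong (_^ n) (sym (ℤP.pos-* u v)) ⟩
        (+ (u ℕ.* v)) ^ n    ∎))

    ∈H-^ : ∀ {x z} j → x ∈ H → z ℕ.< p → + z ≋ (+ x) ^ j → z ∈ H
    ∈H-^ zero _ z<p z≋1 = subst (_∈ H) (≋⇒≡ 1<p z<p (≋-sym z≋1)) 1∈H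
    ∈H-^ {x} (suc j) x∈H z<p z≋xʲ⁺¹ =
      ∈H-* x∈H (∈H-^ j x∈H (m%n<n _ p) (^%-≋ x j)) z<p
        (≋-trans z≋xʲ⁺¹ (≋-* (≋-refl {+ x}) (≋-sym (^%-≋ x j))))

    module Multiplication {c : ℕ} (c∈H : c ∈ H) {f : ℕ → ℕ}
        (f<p : ∀ x → f x ℕ.< p) (f≋ : ∀ x → + f x ≋ + c * + x) where

      f-∈H : ∀ {x} → x ∈ H → f x ∈ H
      f-∈H x∈H = ∈H-* c∈H x∈H (f<p _) (f≋ _)

      f-injective : ∀ {x y} → x ∈ H → y ∈ H → f x ≡ f y → x ≡ y
      f-injective {x} {y} x∈H y∈H fx≡fy = ≋⇒≡ (∈H⇒<p x∈H) (∈H⇒<p y∈H) (*-cancelˡ-≋ (∈H⇒Unit c∈H) (begin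
        + c * + x ≈⟨ ≋-sym (f≋ x) ⟩
        + f x     ≡⟨ cong +_ fx≡fy ⟩
        + f y     ≈⟨ f≋ y ⟩
        + c * + y ∎))

      f-↭ : map f H ↭ H
      f-↭ = injectiveOn⇒map↭ f H-unique f-∈H f-injective

      f-surjective : ∀ {y} → y ∈ H → ∃ λ x → x ∈ H × f x ≡ y
      f-surjective y∈H = let x , x∈H , y≡fx = ∈-map⁻ f (∈-resp-↭ (↭-sym f-↭) y∈H) in x , x∈H , sym y≡fx

    ∏H : ℤ
    ∏H = ℤ*ₚ.∏ H +_

    ∏H-unit : Unit ∏H
    ∏H-unit = Unit-∏ H ∈H⇒Unit

    -- multiplication by c permutes H, so ∏H ≋ c ^ m * ∏H
    ^m≋1 : ∀ {c} → c ∈ H → (+ c) ^ m ≋ + 1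
    ^m≋1 {c} c∈H = *-cancelˡ-≋ ∏H-unit (begin
      ∏H * (+ c) ^ m                ≡⟨ ℤP.*-comm ∏H _ ⟩
      (+ c) ^ m * ∏H                ≡⟨ cong (_* ∏H) (sym (∏-const H (+ c))) ⟩
      ℤ*ₚ.∏ H (λ _ → + c) * ∏H      ≈⟨ ≋-sym (ℤ*ₚ.∏-∙ H (λ _ → + c) +_) ⟩
      ℤ*ₚ.∏ H (λ x → + c * + x)     ≈⟨ ℤ*ₚ.∏-cong H (λ {x} _ → ≋-sym (f≋ x)) ⟩
      ℤ*ₚ.∏ H (λ x → + f x)         ≡⟨ sym (ℤ*ₚ.∏-map f H +_) ⟩
      ℤ*ₚ.∏ (map f H) +_            ≈⟨ ℤ*ₚ.∏-↭ +_ f-↭ ⟩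
      ∏H                            ≡⟨ sym (ℤP.*-identityʳ ∏H) ⟩
      ∏H * + 1                      ∎)
      where
      f : ℕ → ℕ
      f x = (c ℕ.* x) % p
      f≋ : ∀ x → + f x ≋ + c * + x
      f≋ x = ≋-trans (%-≋ _) (≋-reflexive (ℤP.pos-* c x))
      open Multiplication c∈H (λ x → m%n<n (c ℕ.* x) p) f≋ using (f-↭)

    m≡1+[m∸1] : m ≡ suc (m ℕ.∸ 1)
    m≡1+[m∸1] = nonempty 1∈H
      where
      nonempty : ∀ {x} {xs : List ℕ} → x ∈ xs → length xs ≡ suc (length xs ℕ.∸ 1)
      nonempty {xs = _ ∷ _} _ = refl

    -- c ÷ y is the solution z ∈ H of y z ≋ c, computed as c y^(m-1) by Lagrange
    _÷_ : ℕ → ℕ → ℕ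
    c ÷ y = (c ℕ.* y ℕ.^ (m ℕ.∸ 1)) % p

    *÷≋ : ∀ c {y} → y ∈ H → + y * + (c ÷ y) ≋ + c
    *÷≋ c {y} y∈H = begin
      + y * + (c ÷ y)                       ≈⟨ ≋-* (≋-refl {+ y}) (%-≋ _) ⟩
      + y * + (c ℕ.* y ℕ.^ (m ℕ.∸ 1))       ≡⟨ cong (+ y *_) (ℤP.pos-* c (y ℕ.^ (m ℕ.∸ 1))) ⟩
      + y * (+ c * + (y ℕ.^ (m ℕ.∸ 1)))     ≡⟨ cong (λ z → + y * (+ c * z)) (pos-^ y (m ℕ.∸ 1)) ⟩
      + y * (+ c * (+ y) ^ (m ℕ.∸ 1))       ≡⟨ lemma (+ y) (+ c) _ ⟩
      + c * (+ y) ^ suc (m ℕ.∸ 1)           ≡⟨ cong (λ k → + c * (+ y) ^ k) (sym m≡1+[m∸1]) ⟩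
      + c * (+ y) ^ m                       ≈⟨ ≋-* (≋-refl {+ c}) (^m≋1 y∈H) ⟩
      + c * + 1                             ≡⟨ ℤP.*-identityʳ (+ c) ⟩
      + c                                   ∎
      where
      lemma : ∀ y c a → y * (c * a) ≡ c * (y * a)
      lemma = solve-∀

    ÷-unique : ∀ c {y z} → y ∈ H → z ℕ.< p → + y * + z ≋ + c → c ÷ y ≡ z
    ÷-unique c y∈H z<p yz≋c =
      ≋⇒≡ (m%n<n _ p) z<p (*-cancelˡ-≋ (∈H⇒Unit y∈H) (≋-trans (*÷≋ c y∈H) (≋-sym yz≋c)))

    ÷-∈H : ∀ {c y} → c ∈ H → y ∈ H → c ÷ y ∈ H
    ÷-∈H {c} {y} c∈H y∈H =
      ∈H-* c∈H (∈H-^ (m ℕ.∸ 1) y∈H (m%n<n _ p) (^%-≋ y (m ℕ.∸ 1))) (m%n<n _ p) (begin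
        + (c ÷ y)                                  ≈⟨ %-≋ _ ⟩
        + (c ℕ.* y ℕ.^ (m ℕ.∸ 1))                  ≡⟨ ℤP.pos-* c (y ℕ.^ (m ℕ.∸ 1)) ⟩
        + c * + (y ℕ.^ (m ℕ.∸ 1))                  ≈⟨ ≋-* (≋-refl {+ c}) (≋-sym (%-≋ _)) ⟩
        + c * + ((y ℕ.^ (m ℕ.∸ 1)) % p)            ∎)

    ÷-IsInvolutionOn : ∀ {c} → c ∈ H → IsInvolutionOn (c ÷_) H
    ÷-IsInvolutionOn {c} c∈H = record
      { ∈-closed = ÷-∈H c∈H
      ; involutive = λ {y} y∈H → ÷-unique c (÷-∈H c∈H y∈H) (∈H⇒<p y∈H)
          (≋-trans (≋-reflexive (ℤP.*-comm _ (+ y))) (*÷≋ c y∈H)) }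

    -- outside the fixed points ds, the elements of H fall into pairs {y, c ÷ y} of product c
    ÷-pairing : ∀ {c} ds {L} → c ∈ H → H ↭ ds ++ L → (∀ {d} → d ∈ ds → c ÷ d ∈ ds) →
      (∀ {y} → y ∈ H → c ÷ y ≡ y → y ∈ ds) → ∃ λ q → length L ≡ q ℕ.+ q × ℤ*ₚ.∏ L +_ ≋ (+ c) ^ q
    ÷-pairing {c} ds {L} c∈H H↭ ds-closed fixed∈ds =
      length rs , trans (↭-length σ) (length-pairUp (c ÷_) rs) , ∏L≋cᵠ
      where
      u : Unique (ds ++ L)
      u = Unique-resp-↭ H↭ H-unique
      L⊆H : L ⊆ H
      L⊆H y∈L = ∈-resp-↭ (↭-sym H↭) (∈-++⁺ʳ ds y∈L)
      pairs : ∃ λ rs → rs ⊆ L × L ↭ pairUp (c ÷_) rs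
      pairs = fixedPointFree⇒↭pairUp (c ÷_) L (Unique-++⁻ʳ ds u)
        (IsInvolutionOn-++⁻ʳ ds u ds-closed (IsInvolutionOn-resp-↭ H↭ (÷-IsInvolutionOn c∈H)))
        (λ y∈L c÷y≡y → Unique-++⇒∉ ds u (fixed∈ds (L⊆H y∈L) c÷y≡y) y∈L)
      rs : List ℕ
      rs = proj₁ pairs
      σ : L ↭ pairUp (c ÷_) rs
      σ = proj₂ (proj₂ pairs)
      ∏L≋cᵠ : ℤ*ₚ.∏ L +_ ≋ (+ c) ^ length rs
      ∏L≋cᵠ = begin
        ℤ*ₚ.∏ L +_                             ≈⟨ ℤ*ₚ.∏-↭ +_ σ ⟩
        ℤ*ₚ.∏ (pairUp (c ÷_) rs) +_            ≈⟨ ℤ*ₚ.∏-pairUp (c ÷_) rs +_ ⟩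
        ℤ*ₚ.∏ rs (λ r → + r * + (c ÷ r))       ≈⟨ ℤ*ₚ.∏-cong rs (λ r∈ → *÷≋ c (L⊆H (proj₁ (proj₂ pairs) r∈))) ⟩
        ℤ*ₚ.∏ rs (λ _ → + c)                   ≡⟨ ∏-const rs (+ c) ⟩
        (+ c) ^ length rs                      ∎

    1÷-fixed : ∀ {y} → y ∈ H → 1 ÷ y ≡ y → y ≡ 1 ⊎ y ≡ p ℕ.∸ 1
    1÷-fixed {y} y∈H 1÷y≡y =
      square≋1⇒≡±1 (∈H⇒<p y∈H) (subst (λ z → + y * + z ≋ + 1) 1÷y≡y (*÷≋ 1 y∈H))

    1÷1≡1 : 1 ÷ 1 ≡ 1
    1÷1≡1 = ÷-unique 1 1∈H 1<p ≋-refl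

    1÷[p-1]≡p-1 : p ℕ.∸ 1 ∈ H → 1 ÷ (p ℕ.∸ 1) ≡ p ℕ.∸ 1
    1÷[p-1]≡p-1 p-1∈H = ÷-unique 1 p-1∈H p-1<p (≋-* p-1≋-1 p-1≋-1)

    -- Wilson's theorem for H: pairing y with 1 ÷ y leaves only the self-inverse elements 1 and p - 1
    p-1∉H⇒m-odd : p ℕ.∸ 1 ∉ H → ∃ λ q → m ≡ suc (q ℕ.+ q)
    p-1∉H⇒m-odd p-1∉H =
      q , trans (↭-length σ) (cong suc length≡q+q)
      where
      removed : ∃ λ L → H ↭ 1 ∷ L
      removed = ∈⇒↭∷ 1∈H
      L : List ℕ
      L = proj₁ removed
      σ : H ↭ 1 ∷ L
      σ = proj₂ removed
      closed : ∀ {d} → d ∈ 1 ∷ [] → 1 ÷ d ∈ 1 ∷ []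
      closed (here refl) = here 1÷1≡1
      fixed∈ : ∀ {y} → y ∈ H → 1 ÷ y ≡ y → y ∈ 1 ∷ []
      fixed∈ y∈H 1÷y≡y =
        [ here , (λ y≡p-1 → ⊥-elim (p-1∉H (subst (_∈ H) y≡p-1 y∈H))) ]′ (1÷-fixed y∈H 1÷y≡y)
      paired : ∃ λ q → length L ≡ q ℕ.+ q × ℤ*ₚ.∏ L +_ ≋ (+ 1) ^ q
      paired = ÷-pairing (1 ∷ []) 1∈H σ closed fixed∈
      q : ℕ
      q = proj₁ paired
      length≡q+q : length L ≡ q ℕ.+ q
      length≡q+q = proj₁ (proj₂ paired)

    p-1∈H⇒∏H≋-1 : ¬ p ≡ 2 → p ℕ.∸ 1 ∈ H → ∏H ≋ - + 1
    p-1∈H⇒∏H≋-1 p≢2 p-1∈H = begin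
      ∏H                                     ≈⟨ ℤ*ₚ.∏-↭ +_ σ ⟩
      + 1 * (+ (p ℕ.∸ 1) * ℤ*ₚ.∏ L₂ +_)       ≈⟨ ≋-* (≋-refl {+ 1}) (≋-* p-1≋-1 ∏L₂≋1) ⟩
      + 1 * (- + 1 * (+ 1) ^ q)              ≡⟨ cong (λ z → + 1 * (- + 1 * z)) (ℤP.^-zeroˡ q) ⟩
      - + 1                                  ∎
      where
      p-1≢1 : ¬ p ℕ.∸ 1 ≡ 1
      p-1≢1 p-1≡1 = p≢2 (trans (sym (ℕP.m∸n+n≡m (ℕP.<⇒≤ 1<p))) (cong (ℕ._+ 1) p-1≡1))
      removed₁ : ∃ λ L → H ↭ 1 ∷ L
      removed₁ = ∈⇒↭∷ 1∈H
      p-1∈L₁ : p ℕ.∸ 1 ∈ proj₁ removed₁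
      p-1∈L₁ = ∈-∷⁻ (∈-resp-↭ (proj₂ removed₁) p-1∈H) p-1≢1
      removed₂ : ∃ λ L → proj₁ removed₁ ↭ p ℕ.∸ 1 ∷ L
      removed₂ = ∈⇒↭∷ p-1∈L₁
      L₂ : List ℕ
      L₂ = proj₁ removed₂
      σ : H ↭ 1 ∷ p ℕ.∸ 1 ∷ L₂
      σ = ↭-trans (proj₂ removed₁) (↭-prep 1 (proj₂ removed₂))
      closed : ∀ {d} → d ∈ 1 ∷ p ℕ.∸ 1 ∷ [] → 1 ÷ d ∈ 1 ∷ p ℕ.∸ 1 ∷ []
      closed (here refl) = here 1÷1≡1
      closed (there (here refl)) = there (here (1÷[p-1]≡p-1 p-1∈H))
      fixed∈ : ∀ {y} → y ∈ H → 1 ÷ y ≡ y → y ∈ 1 ∷ p ℕ.∸ 1 ∷ []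
      fixed∈ y∈H 1÷y≡y = [ here , there ∘ here ]′ (1÷-fixed y∈H 1÷y≡y)
      paired : ∃ λ q → length L₂ ≡ q ℕ.+ q × ℤ*ₚ.∏ L₂ +_ ≋ (+ 1) ^ q
      paired = ÷-pairing (1 ∷ p ℕ.∸ 1 ∷ []) 1∈H σ closed fixed∈
      q : ℕ
      q = proj₁ paired
      ∏L₂≋1 : ℤ*ₚ.∏ L₂ +_ ≋ (+ 1) ^ q
      ∏L₂≋1 = proj₂ (proj₂ paired)

module Zolotarev where

  open import Data.Bool using (true; false; if_then_else_; _∧_)
  open import Data.Bool.Properties using (T-≡)
  open import Function.Bundles using (Equivalence)
  open import Function using (_∘_)
  open import Data.Nat as ℕ using (ℕ; suc; _<ᵇ_; _≡ᵇ_; ∣_-_∣)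
  import Data.Nat.Properties as ℕP
  open import Data.Nat.Tactic.RingSolver using (solve-∀)
  open import Data.List using (List; []; _∷_; map; length)
  open import Data.List.Membership.Propositional using (_∈_)
  open import Data.List.Relation.Unary.Any using (here; there)
  open import Data.List.Relation.Unary.All as All using (All; []; _∷_)
  open import Data.List.Relation.Unary.AllPairs using ([]; _∷_)
  open import Data.List.Relation.Unary.Unique.Propositional using (Unique)
  open import Data.List.Relation.Binary.Permutation.Propositional using (_↭_)
  open import Data.Empty using (⊥-elim)
  open import Relation.Nullary using (¬_; yes; no)
  open import Relation.Binary.Definitions using (tri<; tri≈; tri>)
  open import Relation.Binary.PropositionalEquality
    using (_≡_; refl; sym; trans; cong; cong₂; subst; module ≡-Reasoning)
  open import Data.Nat.Primality using (Prime)
  open import Data.Integer as ℤ using (ℤ; +_; -_; _^_)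
  import Data.Integer.Properties as ℤP
  open import Data.Integer.Tactic.RingSolver using () renaming (solve-∀ to ℤsolve-∀)
  open import Defs using (inversions)
  open BigOperators using (module BigOperator)
  open Congruence using (module Modulo; pos-∸)

  -- ℕ+.∏ xs f unfolds to sum (map f xs), so Defs.inversions is a double ℕ+.∏
  module ℕ+ = BigOperator ℕP.+-0-commutativeMonoid
  module ℕ* = BigOperator ℕP.*-1-commutativeMonoid

  <ᵇ-true : ∀ {x y} → x ℕ.< y → (x <ᵇ y) ≡ true
  <ᵇ-true x<y = Equivalence.to T-≡ (ℕP.<⇒<ᵇ x<y)

  <ᵇ-false : ∀ {x y} → y ℕ.≤ x → (x <ᵇ y) ≡ false
  <ᵇ-false {x} {y} y≤x with x <ᵇ y in eq
  ... | false = refl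
  ... | true = ⊥-elim (ℕP.≤⇒≯ y≤x (ℕP.<ᵇ⇒< x y (Equivalence.from T-≡ eq)))

  ≡ᵇ-refl : ∀ u → (u ≡ᵇ u) ≡ true
  ≡ᵇ-refl u = Equivalence.to T-≡ (ℕP.≡⇒≡ᵇ u u refl)

  ≡ᵇ-false : ∀ {u v} → ¬ u ≡ v → (u ≡ᵇ v) ≡ false
  ≡ᵇ-false {u} {v} u≢v with u ≡ᵇ v in eq
  ... | false = refl
  ... | true = ⊥-elim (u≢v (ℕP.≡ᵇ⇒≡ u v (Equivalence.from T-≡ eq)))

  pairs< : List ℕ → ℕ
  pairs< xs = ℕ+.∏ xs (λ x → ℕ+.∏ xs (λ y → if x <ᵇ y then 1 else 0))

  [<]+[>]≡1 : ∀ {x y} → ¬ x ≡ y → (if x <ᵇ y then 1 else 0) ℕ.+ (if y <ᵇ x then 1 else 0) ≡ 1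
  [<]+[>]≡1 {x} {y} x≢y with ℕP.<-cmp x y
  ... | tri< x<y _ _ rewrite <ᵇ-true x<y | <ᵇ-false (ℕP.<⇒≤ x<y) = refl
  ... | tri≈ _ x≡y _ = ⊥-elim (x≢y x≡y)
  ... | tri> _ _ y<x rewrite <ᵇ-false (ℕP.<⇒≤ y<x) | <ᵇ-true y<x = refl

  count-above+below : ∀ x (ys : List ℕ) → All (λ y → ¬ x ≡ y) ys →
    ℕ+.∏ ys (λ y → if x <ᵇ y then 1 else 0) ℕ.+ ℕ+.∏ ys (λ y → if y <ᵇ x then 1 else 0) ≡ length ys
  count-above+below x ys x≢ys = begin
    ℕ+.∏ ys (λ y → if x <ᵇ y then 1 else 0) ℕ.+ ℕ+.∏ ys (λ y → if y <ᵇ x then 1 else 0)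
      ≡⟨ ℕ+.∏-∙ ys _ _ ⟨
    ℕ+.∏ ys (λ y → (if x <ᵇ y then 1 else 0) ℕ.+ (if y <ᵇ x then 1 else 0))
      ≡⟨ ℕ+.∏-cong ys (λ y∈ → [<]+[>]≡1 (All.lookup x≢ys y∈)) ⟩
    ℕ+.∏ ys (λ _ → 1)
      ≡⟨ ∏1≡length ys ⟩
    length ys ∎
    where
    open ≡-Reasoning
    ∏1≡length : (ys : List ℕ) → ℕ+.∏ ys (λ _ → 1) ≡ length ys
    ∏1≡length [] = refl
    ∏1≡length (_ ∷ ys) = cong suc (∏1≡length ys)

  pairs<-∷ : ∀ x ys → All (λ y → ¬ x ≡ y) ys → pairs< (x ∷ ys) ≡ length ys ℕ.+ pairs< ys
  pairs<-∷ x ys x≢ys = begin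
    pairs< (x ∷ ys)
      ≡⟨ cong (λ b → (if b then 1 else 0) ℕ.+ above ℕ.+ rest) (<ᵇ-false (ℕP.≤-refl {x})) ⟩
    above ℕ.+ ℕ+.∏ ys (λ x′ → (if x′ <ᵇ x then 1 else 0) ℕ.+ ℕ+.∏ ys (λ y → if x′ <ᵇ y then 1 else 0))
      ≡⟨ cong (above ℕ.+_) (ℕ+.∏-∙ ys _ _) ⟩
    above ℕ.+ (below ℕ.+ pairs< ys)
      ≡⟨ ℕP.+-assoc above below _ ⟨
    above ℕ.+ below ℕ.+ pairs< ys
      ≡⟨ cong (ℕ._+ pairs< ys) (count-above+below x ys x≢ys) ⟩
    length ys ℕ.+ pairs< ys ∎
    where
    open ≡-Reasoning
    above below rest : ℕ
    above = ℕ+.∏ ys (λ y → if x <ᵇ y then 1 else 0)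
    rest = ℕ+.∏ ys (λ x′ → ℕ+.∏ (x ∷ ys) (λ y → if x′ <ᵇ y then 1 else 0))
    below = ℕ+.∏ ys (λ y → if y <ᵇ x then 1 else 0)

  pairs<-formula : ∀ xs → Unique xs → pairs< xs ℕ.* 2 ℕ.+ length xs ≡ length xs ℕ.* length xs
  pairs<-formula [] [] = refl
  pairs<-formula (x ∷ xs) (x≢xs ∷ u) = begin
    pairs< (x ∷ xs) ℕ.* 2 ℕ.+ suc l              ≡⟨ cong (λ e → e ℕ.* 2 ℕ.+ suc l) (pairs<-∷ x xs x≢xs) ⟩
    (l ℕ.+ pairs< xs) ℕ.* 2 ℕ.+ suc l            ≡⟨ lemma₁ l (pairs< xs) ⟩
    2 ℕ.* l ℕ.+ (pairs< xs ℕ.* 2 ℕ.+ l) ℕ.+ 1    ≡⟨ cong (λ z → 2 ℕ.* l ℕ.+ z ℕ.+ 1) (pairs<-formula xs u) ⟩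
    2 ℕ.* l ℕ.+ l ℕ.* l ℕ.+ 1                    ≡⟨ lemma₂ l ⟩
    suc l ℕ.* suc l                              ∎
    where
    open ≡-Reasoning
    l : ℕ
    l = length xs
    lemma₁ : ∀ l e → (l ℕ.+ e) ℕ.* 2 ℕ.+ suc l ≡ 2 ℕ.* l ℕ.+ (e ℕ.* 2 ℕ.+ l) ℕ.+ 1
    lemma₁ = solve-∀
    lemma₂ : ∀ l → 2 ℕ.* l ℕ.+ l ℕ.* l ℕ.+ 1 ≡ suc l ℕ.* suc l
    lemma₂ = solve-∀

  gap : (ℕ → ℕ) → ℕ → ℕ → ℕ
  gap g x y = if x <ᵇ y then ∣ g y - g x ∣ else 1

  Δ : List ℕ → (ℕ → ℕ) → ℕ
  Δ xs g = ℕ*.∏ xs (λ x → ℕ*.∏ xs (gap g x))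

  -- ∣ u - v ∣, but 1 on the diagonal: the product of dist₁ over all ordered pairs is Δ squared
  dist₁ : ℕ → ℕ → ℕ
  dist₁ u v = if u ≡ᵇ v then 1 else ∣ u - v ∣

  Δ² : List ℕ → (ℕ → ℕ) → ℕ
  Δ² xs g = ℕ*.∏ xs (λ x → ℕ*.∏ xs (λ y → dist₁ (g x) (g y)))

  dist₁-split : ∀ (g : ℕ → ℕ) {x y} → (g x ≡ g y → x ≡ y) →
    dist₁ (g x) (g y) ≡ gap g x y ℕ.* gap g y x
  dist₁-split g {x} {y} inj with ℕP.<-cmp x y
  ... | tri< x<y x≢y _ rewrite <ᵇ-true x<y | <ᵇ-false (ℕP.<⇒≤ x<y) | ≡ᵇ-false (x≢y ∘ inj) =
    trans (ℕP.∣-∣-comm (g x) (g y)) (sym (ℕP.*-identityʳ _))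
  ... | tri≈ _ refl _ rewrite <ᵇ-false (ℕP.≤-refl {x}) | ≡ᵇ-refl (g x) = refl
  ... | tri> _ x≢y y<x rewrite <ᵇ-false (ℕP.<⇒≤ y<x) | <ᵇ-true y<x | ≡ᵇ-false (x≢y ∘ inj) =
    sym (ℕP.+-identityʳ _)

  Δ²≡Δ*Δ : ∀ (g : ℕ → ℕ) xs → (∀ {x y} → x ∈ xs → y ∈ xs → g x ≡ g y → x ≡ y) →
    Δ² xs g ≡ Δ xs g ℕ.* Δ xs g
  Δ²≡Δ*Δ g xs inj = begin
    Δ² xs g
      ≡⟨ ℕ*.∏-cong xs (λ x∈ → ℕ*.∏-cong xs (λ y∈ → dist₁-split g (inj x∈ y∈))) ⟩
    ℕ*.∏ xs (λ x → ℕ*.∏ xs (λ y → gap g x y ℕ.* gap g y x))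
      ≡⟨ ℕ*.∏-cong xs (λ {x} _ → ℕ*.∏-∙ xs (gap g x) (λ y → gap g y x)) ⟩
    ℕ*.∏ xs (λ x → ℕ*.∏ xs (gap g x) ℕ.* ℕ*.∏ xs (λ y → gap g y x))
      ≡⟨ ℕ*.∏-∙ xs _ _ ⟩
    Δ xs g ℕ.* ℕ*.∏ xs (λ x → ℕ*.∏ xs (λ y → gap g y x))
      ≡⟨ cong (Δ xs g ℕ.*_) (ℕ*.∏-swap xs xs (λ x y → gap g y x)) ⟩
    Δ xs g ℕ.* Δ xs g ∎
    where open ≡-Reasoning

  Δ²-↭ : ∀ (f : ℕ → ℕ) {xs} → map f xs ↭ xs → Δ² xs f ≡ Δ² xs (λ x → x)
  Δ²-↭ f {xs} σ = begin
    ℕ*.∏ xs (λ x → ℕ*.∏ xs (λ y → dist₁ (f x) (f y)))   ≡⟨ ℕ*.∏-map f xs _ ⟨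
    ℕ*.∏ (map f xs) (λ u → ℕ*.∏ xs (λ y → dist₁ u (f y)))  ≡⟨ ℕ*.∏-↭ _ σ ⟩
    ℕ*.∏ xs (λ u → ℕ*.∏ xs (λ y → dist₁ u (f y)))       ≡⟨ ℕ*.∏-cong xs (λ {u} _ → inner u) ⟩
    ℕ*.∏ xs (λ u → ℕ*.∏ xs (dist₁ u))                   ∎
    where
    open ≡-Reasoning
    inner : ∀ u → ℕ*.∏ xs (λ y → dist₁ u (f y)) ≡ ℕ*.∏ xs (dist₁ u)
    inner u = trans (sym (ℕ*.∏-map f xs (dist₁ u))) (ℕ*.∏-↭ (dist₁ u) σ)

  *-self-injective : ∀ {a b} → a ℕ.* a ≡ b ℕ.* b → a ≡ b
  *-self-injective {a} {b} a²≡b² with ℕP.<-cmp a b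
  ... | tri< a<b _ _ = ⊥-elim (ℕP.<-irrefl a²≡b² (ℕP.*-mono-< a<b a<b))
  ... | tri≈ _ a≡b _ = a≡b
  ... | tri> _ _ b<a = ⊥-elim (ℕP.<-irrefl (sym a²≡b²) (ℕP.*-mono-< b<a b<a))

  -- Δ xs f is the square root of Δ² xs f, which is invariant under permuting xs
  Δ-↭ : ∀ (f : ℕ → ℕ) {xs} → (∀ {x y} → x ∈ xs → y ∈ xs → f x ≡ f y → x ≡ y) → map f xs ↭ xs →
    Δ xs f ≡ Δ xs (λ x → x)
  Δ-↭ f {xs} inj σ = *-self-injective (begin
    Δ xs f ℕ.* Δ xs f                      ≡⟨ Δ²≡Δ*Δ f xs inj ⟨
    Δ² xs f                                ≡⟨ Δ²-↭ f σ ⟩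
    Δ² xs (λ x → x)                        ≡⟨ Δ²≡Δ*Δ (λ x → x) xs (λ _ _ x≡y → x≡y) ⟩
    Δ xs (λ x → x) ℕ.* Δ xs (λ x → x)      ∎)
    where open ≡-Reasoning

  diff-sign : ∀ v u → + v ℤ.- + u ≡ (- + 1) ^ (if v <ᵇ u then 1 else 0) ℤ.* + ∣ v - u ∣
  diff-sign v u with v ℕP.<? u
  ... | yes v<u rewrite <ᵇ-true v<u = begin
    + v ℤ.- + u           ≡⟨ swap (+ v) (+ u) ⟩
    - (+ u ℤ.- + v)       ≡⟨ cong -_ (pos-∸ (ℕP.<⇒≤ v<u)) ⟨
    - + (u ℕ.∸ v)         ≡⟨ cong (λ d → - + d) (ℕP.m≤n⇒∣m-n∣≡n∸m (ℕP.<⇒≤ v<u)) ⟨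
    - + ∣ v - u ∣         ≡⟨ ℤP.-1*i≡-i _ ⟨
    - + 1 ℤ.* + ∣ v - u ∣ ∎
    where
    open ≡-Reasoning
    swap : ∀ a b → a ℤ.- b ≡ - (b ℤ.- a)
    swap = ℤsolve-∀
  ... | no v≮u rewrite <ᵇ-false (ℕP.≮⇒≥ v≮u) = begin
    + v ℤ.- + u           ≡⟨ pos-∸ u≤v ⟨
    + (v ℕ.∸ u)           ≡⟨ cong +_ (ℕP.m≤n⇒∣n-m∣≡n∸m u≤v) ⟨
    + ∣ v - u ∣           ≡⟨ ℤP.*-identityˡ _ ⟨
    + 1 ℤ.* + ∣ v - u ∣   ∎
    where
    open ≡-Reasoning
    u≤v : u ℕ.≤ v
    u≤v = ℕP.≮⇒≥ v≮u

  inversions-constant : ∀ {c} xs (f : ℕ → ℕ) → (∀ {x} → x ∈ xs → x ≡ c) → inversions xs f ≡ 0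
  inversions-constant {c} xs f ≡c = trans (ℕ+.∏-cong xs row≡0) (ℕ+.∏-ε xs)
    where
    no-inversion : ∀ {x y} → x ≡ c → y ≡ c → (if (x <ᵇ y) ∧ (f y <ᵇ f x) then 1 else 0) ≡ 0
    no-inversion refl refl rewrite <ᵇ-false (ℕP.≤-refl {c}) = refl
    row≡0 : ∀ {x} → x ∈ xs → ℕ+.∏ xs (λ y → if (x <ᵇ y) ∧ (f y <ᵇ f x) then 1 else 0) ≡ 0
    row≡0 x∈ = trans (ℕ+.∏-cong xs (λ y∈ → no-inversion (≡c x∈) (≡c y∈))) (ℕ+.∏-ε xs)

  module ModularSign (p : ℕ) (pr : Prime p) where

    open Modulo p pr
    open import Relation.Binary.Reasoning.Setoid ≋-setoid

    pos-∏ : ∀ xs (g : ℕ → ℕ) → + ℕ*.∏ xs g ≡ ℤ*ₚ.∏ xs (λ x → + g x)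
    pos-∏ [] g = refl
    pos-∏ (x ∷ xs) g = trans (ℤP.pos-* (g x) _) (cong (+ g x ℤ.*_) (pos-∏ xs g))

    ∏-split : ∀ (z : ℤ) xs (w : ℕ → ℤ) (s v : ℕ → ℕ) → (∀ {x} → x ∈ xs → w x ≋ z ^ s x ℤ.* + v x) →
      ℤ*ₚ.∏ xs w ≋ z ^ ℕ+.∏ xs s ℤ.* + ℕ*.∏ xs v
    ∏-split z [] w s v _ = ≋-refl
    ∏-split z (x ∷ xs) w s v w≋ = begin
      w x ℤ.* ℤ*ₚ.∏ xs w
        ≈⟨ ≋-* (w≋ (here refl)) (∏-split z xs w s v (λ x∈ → w≋ (there x∈))) ⟩
      z ^ s x ℤ.* + v x ℤ.* (z ^ ℕ+.∏ xs s ℤ.* + ℕ*.∏ xs v)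
        ≡⟨ interchange (z ^ s x) (+ v x) _ _ ⟩
      z ^ s x ℤ.* z ^ ℕ+.∏ xs s ℤ.* (+ v x ℤ.* + ℕ*.∏ xs v)
        ≡⟨ cong₂ ℤ._*_ (sym (ℤP.^-distribˡ-+-* z (s x) _)) (sym (ℤP.pos-* (v x) _)) ⟩
      z ^ ℕ+.∏ (x ∷ xs) s ℤ.* + ℕ*.∏ (x ∷ xs) v ∎
      where
      interchange : ∀ a b c d → a ℤ.* b ℤ.* (c ℤ.* d) ≡ a ℤ.* c ℤ.* (b ℤ.* d)
      interchange = ℤsolve-∀

    ∏∏-split : ∀ (z : ℤ) xs (w : ℕ → ℕ → ℤ) (s v : ℕ → ℕ → ℕ) →
      (∀ {x y} → x ∈ xs → y ∈ xs → w x y ≋ z ^ s x y ℤ.* + v x y) →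
      ℤ*ₚ.∏ xs (λ x → ℤ*ₚ.∏ xs (w x)) ≋
        z ^ ℕ+.∏ xs (λ x → ℕ+.∏ xs (s x)) ℤ.* + ℕ*.∏ xs (λ x → ℕ*.∏ xs (v x))
    ∏∏-split z xs w s v w≋ = ∏-split z xs _ _ _ (λ x∈ → ∏-split z xs (w _) (s _) (v _) (w≋ x∈))

    Δ-unit : ∀ xs → (∀ {x} → x ∈ xs → x ℕ.< p) → Unit (+ Δ xs (λ x → x))
    Δ-unit xs xs<p = subst Unit (sym (pos-∏ xs _))
      (Unit-∏ xs (λ {x} _ → subst Unit (sym (pos-∏ xs _)) (Unit-∏ xs (λ y∈ → difference-unit x (xs<p y∈)))))
      where
      difference-unit : ∀ x {y} → y ℕ.< p → Unit (+ gap (λ x → x) x y)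
      difference-unit x {y} y<p with x ℕP.<? y
      ... | no x≮y rewrite <ᵇ-false (ℕP.≮⇒≥ x≮y) = Unit-1
      ... | yes x<y rewrite <ᵇ-true x<y | ℕP.m≤n⇒∣n-m∣≡n∸m (ℕP.<⇒≤ x<y) =
        Unit-pos (ℕP.m<n⇒0<n∸m x<y) (ℕP.≤-<-trans (ℕP.m∸n≤m y x) y<p)

    -- Zolotarev: compare ∏_{x<y} (f y - f x) with ∏_{x<y} (y - x) exactly and modulo p
    sign≋ : ∀ xs → (∀ {x} → x ∈ xs → x ℕ.< p) → (f : ℕ → ℕ) (c : ℕ) → (∀ x → + f x ≋ + c ℤ.* + x) →
      (∀ {x y} → x ∈ xs → y ∈ xs → f x ≡ f y → x ≡ y) → map f xs ↭ xs →
      (- + 1) ^ inversions xs f ≋ (+ c) ^ pairs< xs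
    sign≋ xs xs<p f c f≋ inj σ = *-cancelˡ-≋ (Δ-unit xs xs<p) (begin
      + Δ xs id ℤ.* (- + 1) ^ inversions xs f    ≡⟨ ℤP.*-comm (+ Δ xs id) _ ⟩
      (- + 1) ^ inversions xs f ℤ.* + Δ xs id    ≡⟨ cong (λ d → (- + 1) ^ inversions xs f ℤ.* + d) (Δ-↭ f inj σ) ⟨
      (- + 1) ^ inversions xs f ℤ.* + Δ xs f     ≈⟨ ≋-sym (∏∏-split (- + 1) xs D inversion (gap f) signed) ⟩
      ℤ*ₚ.∏ xs (λ x → ℤ*ₚ.∏ xs (D x))            ≈⟨ ∏∏-split (+ c) xs D (λ x y → if x <ᵇ y then 1 else 0) (gap id) scaled ⟩
      (+ c) ^ pairs< xs ℤ.* + Δ xs id            ≡⟨ ℤP.*-comm _ (+ Δ xs id) ⟩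
      + Δ xs id ℤ.* (+ c) ^ pairs< xs            ∎)
      where
      id : ℕ → ℕ
      id x = x
      D : ℕ → ℕ → ℤ
      D x y = if x <ᵇ y then + f y ℤ.- + f x else + 1
      inversion : ℕ → ℕ → ℕ
      inversion x y = if (x <ᵇ y) ∧ (f y <ᵇ f x) then 1 else 0
      signed : ∀ {x y} → x ∈ xs → y ∈ xs → D x y ≋ (- + 1) ^ inversion x y ℤ.* + gap f x y
      signed {x} {y} _ _ with x <ᵇ y
      ... | false = ≋-refl
      ... | true = ≋-reflexive (diff-sign (f y) (f x))
      scaled : ∀ {x y} → x ∈ xs → y ∈ xs → D x y ≋ (+ c) ^ (if x <ᵇ y then 1 else 0) ℤ.* + gap id x y
      scaled {x} {y} _ _ with x ℕP.<? y
      ... | no x≮y rewrite <ᵇ-false (ℕP.≮⇒≥ x≮y) = ≋-refl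
      ... | yes x<y rewrite <ᵇ-true x<y = begin
        + f y ℤ.- + f x               ≈⟨ ≋-- (f≋ y) (f≋ x) ⟩
        + c ℤ.* + y ℤ.- + c ℤ.* + x   ≡⟨ factor (+ c) (+ y) (+ x) ⟩
        + c ℤ.* + 1 ℤ.* (+ y ℤ.- + x) ≡⟨ cong (+ c ℤ.* + 1 ℤ.*_) (pos-∸ (ℕP.<⇒≤ x<y)) ⟨
        + c ℤ.* + 1 ℤ.* + (y ℕ.∸ x)   ≡⟨ cong (λ d → + c ℤ.* + 1 ℤ.* + d) (ℕP.m≤n⇒∣n-m∣≡n∸m (ℕP.<⇒≤ x<y)) ⟨
        + c ℤ.* + 1 ℤ.* + ∣ y - x ∣   ∎
        where
        factor : ∀ c y x → c ℤ.* y ℤ.- c ℤ.* x ≡ c ℤ.* + 1 ℤ.* (y ℤ.- x)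
        factor = ℤsolve-∀

module EulerCriterion where

  open import Defs using (IsPowerResidue; mulMap; inversions; sgn)
  open import Data.Nat as ℕ using (ℕ; zero; suc; NonZero)
  import Data.Nat.Properties as ℕP
  open import Data.Nat.Primality using (Prime)
  open import Data.Nat.Tactic.RingSolver using (solve-∀)
  open import Data.Integer.Tactic.RingSolver using () renaming (solve-∀ to ℤsolve-∀)
  open import Data.List.Relation.Binary.Permutation.Propositional using (↭-refl)
  open import Data.Integer as ℤ using (ℤ; +_; -_; _^_)
  import Data.Integer.Properties as ℤP
  open import Data.Integer.DivMod using (_%ℕ_; n%ℕd<d)
  open import Data.Integer.Divisibility.Signed using (∣⇒∣ᵤ; ∣ᵤ⇒∣; ∣m⇒∣m*n)
  open import Data.Integer.Divisibility using () renaming (_∣_ to _∣ᵤ_)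
  open import Function using (_∘_)
  open import Data.List using ([])
  open import Data.List.Membership.Propositional using (_∈_)
  open import Data.List.Membership.DecPropositional ℕP._≟_ using (_∈?_)
  open import Data.Product using (∃; _×_; _,_; proj₁; proj₂)
  open import Data.Sum using (inj₁; inj₂; [_,_]′)
  open import Relation.Nullary.Decidable using (toSum)
  open import Data.Empty using (⊥-elim)
  open import Relation.Nullary using (¬_)
  open import Relation.Binary.PropositionalEquality using (_≡_; refl; sym; trans; cong; cong₂; subst; module ≡-Reasoning)
  open Congruence
  open PowerSubgroups using (module PowerSubgroup)
  open Zolotarev using (pairs<; pairs<-formula; inversions-constant; module ModularSign)

  odd≢even : ∀ a b → ¬ suc (a ℕ.+ a) ≡ b ℕ.+ b
  odd≢even zero zero ()
  odd≢even zero (suc b) e rewrite ℕP.+-suc b b = ℕP.0≢1+n (ℕP.suc-injective e)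
  odd≢even (suc a) zero ()
  odd≢even (suc a) (suc b) e rewrite ℕP.+-suc a a | ℕP.+-suc b b =
    odd≢even a b (ℕP.suc-injective (ℕP.suc-injective e))

  half-pairs : ∀ e m q → e ℕ.* 2 ℕ.+ m ≡ m ℕ.* m → m ≡ q ℕ.+ q → e ℕ.+ q ≡ q ℕ.* (q ℕ.+ q)
  half-pairs e m q e*2+m≡m*m m≡q+q = ℕP.*-cancelʳ-≡ (e ℕ.+ q) (q ℕ.* (q ℕ.+ q)) 2 (begin
    (e ℕ.+ q) ℕ.* 2           ≡⟨ distrib e q ⟩
    e ℕ.* 2 ℕ.+ (q ℕ.+ q)     ≡⟨ cong (e ℕ.* 2 ℕ.+_) m≡q+q ⟨
    e ℕ.* 2 ℕ.+ m             ≡⟨ e*2+m≡m*m ⟩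
    m ℕ.* m                   ≡⟨ cong₂ ℕ._*_ m≡q+q m≡q+q ⟩
    (q ℕ.+ q) ℕ.* (q ℕ.+ q)   ≡⟨ square q ⟩
    q ℕ.* (q ℕ.+ q) ℕ.* 2     ∎)
    where
    open ≡-Reasoning
    distrib : ∀ e q → (e ℕ.+ q) ℕ.* 2 ≡ e ℕ.* 2 ℕ.+ (q ℕ.+ q)
    distrib = solve-∀
    square : ∀ q → (q ℕ.+ q) ℕ.* (q ℕ.+ q) ≡ q ℕ.* (q ℕ.+ q) ℕ.* 2
    square = solve-∀

  module PowerResidueSign (p : ℕ) (pr : Prime p) (n : ℕ) .{{_ : NonZero n}} (a : ℤ)
      (p∤a : ¬ (+ p ∣ᵤ a)) (a-power : IsPowerResidue n a p) where

    open PowerSubgroup p pr n public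
    open ModularSign p pr using (sign≋)
    open import Relation.Binary.Reasoning.Setoid ≋-setoid

    a-unit : Unit a
    a-unit = p∤a ∘ ∣⇒∣ᵤ

    b : ℕ
    b = a %ℕ p

    b≋a : + b ≋ a
    b≋a = %ℕ-≋ a

    φ : ℕ → ℕ
    φ = mulMap a p

    φ≋ : ∀ x → + φ x ≋ + b ℤ.* + x
    φ≋ x = ≋-trans (%ℕ-≋ (a ℤ.* + x)) (≋-* (≋-sym b≋a) (≋-refl {+ x}))

    ≋power⇒∈H : ∀ {y} x → y ℕ.< p → + y ≋ x ^ n → Unit (x ^ n) → y ∈ H
    ≋power⇒∈H {y} x y<p y≋xⁿ xⁿ-unit = ∈H⁺ y<p (x %ℕ p , u-unit , ≋-trans y≋xⁿ (≋-^ n (≋-sym (%ℕ-≋ x))))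
      where
      u-unit : Unit (+ (x %ℕ p))
      u-unit = Unit-resp-≋ (≋-sym (%ℕ-≋ x)) (Unit-^⁻ n xⁿ-unit)

    b∈H : b ∈ H
    b∈H = ≋power⇒∈H x (n%ℕd<d a p) (≋-trans b≋a (≋-sym xⁿ≋a)) (Unit-resp-≋ (≋-sym xⁿ≋a) a-unit)
      where
      x : ℤ
      x = proj₁ a-power
      xⁿ≋a : x ^ n ≋ a
      xⁿ≋a = mk (∣ᵤ⇒∣ (proj₂ a-power))

    open Multiplication b∈H (λ x → n%ℕd<d (a ℤ.* + x) p) φ≋

    φ-∈H : ∀ x → x ∈ H → φ x ∈ H
    φ-∈H _ = f-∈H

    φ-injective : ∀ x y → x ∈ H → y ∈ H → φ x ≡ φ y → x ≡ y
    φ-injective _ _ = f-injective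

    φ-surjective : ∀ y → y ∈ H → ∃ λ x → x ∈ H × φ x ≡ y
    φ-surjective _ = f-surjective

    IsSquareInH : Set
    IsSquareInH = ∃ λ r → r ∈ H × + r ℤ.* + r ≋ + b

    2n≡n+n : 2 ℕ.* n ≡ n ℕ.+ n
    2n≡n+n = cong (n ℕ.+_) (ℕP.+-identityʳ n)

    square⇒power : IsSquareInH → IsPowerResidue (2 ℕ.* n) a p
    square⇒power (r , r∈H , r²≋b) with _ , u , _ , r≋uⁿ ← ∈H⁻ r∈H = + u , ∣⇒∣ᵤ (get (begin
      (+ u) ^ (2 ℕ.* n)         ≡⟨ cong ((+ u) ^_) 2n≡n+n ⟩
      (+ u) ^ (n ℕ.+ n)         ≡⟨ ℤP.^-distribˡ-+-* (+ u) n n ⟩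
      (+ u) ^ n ℤ.* (+ u) ^ n   ≈⟨ ≋-* (≋-sym r≋uⁿ) (≋-sym r≋uⁿ) ⟩
      + r ℤ.* + r               ≈⟨ r²≋b ⟩
      + b                       ≈⟨ b≋a ⟩
      a                         ∎))

    power⇒square : IsPowerResidue (2 ℕ.* n) a p → IsSquareInH
    power⇒square (x , p∣x²ⁿ-a) = r , ≋power⇒∈H x (n%ℕd<d (x ^ n) p) (%ℕ-≋ (x ^ n)) xⁿ-unit , (begin
      + r ℤ.* + r               ≈⟨ ≋-* (%ℕ-≋ (x ^ n)) (%ℕ-≋ (x ^ n)) ⟩
      x ^ n ℤ.* x ^ n           ≈⟨ xⁿxⁿ≋a ⟩
      a                         ≈⟨ ≋-sym b≋a ⟩
      + b                       ∎)
      where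
      r : ℕ
      r = (x ^ n) %ℕ p
      xⁿxⁿ≋a : x ^ n ℤ.* x ^ n ≋ a
      xⁿxⁿ≋a = begin
        x ^ n ℤ.* x ^ n         ≡⟨ ℤP.^-distribˡ-+-* x n n ⟨
        x ^ (n ℕ.+ n)           ≡⟨ cong (x ^_) 2n≡n+n ⟨
        x ^ (2 ℕ.* n)           ≈⟨ mk (∣ᵤ⇒∣ p∣x²ⁿ-a) ⟩
        a                       ∎
      xⁿ-unit : Unit (x ^ n)
      xⁿ-unit xⁿ-multiple = Unit-resp-≋ (≋-sym xⁿxⁿ≋a) a-unit (∣m⇒∣m*n (x ^ n) xⁿ-multiple)

    E : ℕ
    E = pairs< H

    E*2+m≡m*m : E ℕ.* 2 ℕ.+ m ≡ m ℕ.* m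
    E*2+m≡m*m = pairs<-formula H H-unique

    sign≋b^E : (- + 1) ^ inversions H φ ≋ (+ b) ^ E
    sign≋b^E = sign≋ H ∈H⇒<p φ b φ≋ f-injective f-↭

    square⇒b^E≋1 : IsSquareInH → (+ b) ^ E ≋ + 1
    square⇒b^E≋1 (r , r∈H , r²≋b) = begin
      (+ b) ^ E                         ≈⟨ ≋-^ E (≋-sym r²≋b) ⟩
      (+ r ℤ.* + r) ^ E                 ≡⟨ trans (^-distribʳ-* (+ r) (+ r) E) (sym (ℤP.^-distribˡ-+-* (+ r) E E)) ⟩
      (+ r) ^ (E ℕ.+ E)                 ≡⟨ cong ((+ r) ^_) (double E) ⟩
      (+ r) ^ (E ℕ.* 2)                 ≡⟨ ℤP.*-identityʳ ((+ r) ^ (E ℕ.* 2)) ⟨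
      (+ r) ^ (E ℕ.* 2) ℤ.* + 1         ≈⟨ ≋-* (≋-refl {(+ r) ^ (E ℕ.* 2)}) (≋-sym (^m≋1 r∈H)) ⟩
      (+ r) ^ (E ℕ.* 2) ℤ.* (+ r) ^ m   ≡⟨ ℤP.^-distribˡ-+-* (+ r) (E ℕ.* 2) m ⟨
      (+ r) ^ (E ℕ.* 2 ℕ.+ m)           ≡⟨ cong ((+ r) ^_) E*2+m≡m*m ⟩
      (+ r) ^ (m ℕ.* m)                 ≡⟨ ℤP.^-*-assoc (+ r) m m ⟨
      ((+ r) ^ m) ^ m                   ≈⟨ ≋-^ m (^m≋1 r∈H) ⟩
      (+ 1) ^ m                         ≡⟨ ℤP.^-zeroˡ m ⟩
      + 1                               ∎
      where
      double : ∀ e → e ℕ.+ e ≡ e ℕ.* 2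
      double = solve-∀

    nonsquare⇒b^E≋-1 : ¬ p ≡ 2 → ¬ IsSquareInH → (+ b) ^ E ≋ - + 1
    nonsquare⇒b^E≋-1 p≢2 nonsquare = begin
      (+ b) ^ E                                        ≡⟨ lemma ((+ b) ^ E) ⟩
      (+ b) ^ E ℤ.* - + 1 ℤ.* - + 1                     ≈⟨ ≋-* (≋-* (≋-refl {(+ b) ^ E}) (≋-sym b^q≋-1)) (≋-refl { - + 1}) ⟩
      (+ b) ^ E ℤ.* (+ b) ^ q ℤ.* - + 1                 ≡⟨ cong (ℤ._* - + 1) (ℤP.^-distribˡ-+-* (+ b) E q) ⟨
      (+ b) ^ (E ℕ.+ q) ℤ.* - + 1                      ≡⟨ cong (λ k → (+ b) ^ k ℤ.* - + 1) E+q≡q*[q+q] ⟩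
      (+ b) ^ (q ℕ.* (q ℕ.+ q)) ℤ.* - + 1              ≡⟨ cong (ℤ._* - + 1) (ℤP.^-*-assoc (+ b) q (q ℕ.+ q)) ⟨
      ((+ b) ^ q) ^ (q ℕ.+ q) ℤ.* - + 1                ≈⟨ ≋-* (≋-^ (q ℕ.+ q) b^q≋-1) (≋-refl { - + 1}) ⟩
      (- + 1) ^ (q ℕ.+ q) ℤ.* - + 1                    ≡⟨ cong (ℤ._* - + 1) (-1^[k+k]≡1 q) ⟩
      - + 1                                            ∎
      where
      lemma : ∀ x → x ≡ x ℤ.* - + 1 ℤ.* - + 1
      lemma = ℤsolve-∀
      paired : ∃ λ q → m ≡ q ℕ.+ q × ∏H ≋ (+ b) ^ q
      paired = ÷-pairing [] b∈H ↭-refl (λ ())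
        (λ {y} y∈H b÷y≡y → ⊥-elim (nonsquare (y , y∈H , subst (λ z → + y ℤ.* + z ≋ + b) b÷y≡y (*÷≋ b y∈H))))
      q : ℕ
      q = proj₁ paired
      m≡q+q : m ≡ q ℕ.+ q
      m≡q+q = proj₁ (proj₂ paired)
      b^q≋-1 : (+ b) ^ q ≋ - + 1
      b^q≋-1 = [ (λ p-1∈H → ≋-trans (≋-sym (proj₂ (proj₂ paired))) (p-1∈H⇒∏H≋-1 p≢2 p-1∈H))
               , (λ p-1∉H → let q′ , m≡1+q′+q′ = p-1∉H⇒m-odd p-1∉H in
                    ⊥-elim (odd≢even q′ q (trans (sym m≡1+q′+q′) m≡q+q))) ]′ (toSum (p ℕ.∸ 1 ∈? H))
      E+q≡q*[q+q] : E ℕ.+ q ≡ q ℕ.* (q ℕ.+ q)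
      E+q≡q*[q+q] = half-pairs E m q E*2+m≡m*m m≡q+q

    module _ (p≡2 : p ≡ 2) where

      ∈H⇒≡1 : ∀ {y} → y ∈ H → y ≡ 1
      ∈H⇒≡1 {y} y∈H = ℕP.≤-antisym (ℕP.≤-pred (subst (y ℕ.<_) p≡2 (∈H⇒<p y∈H))) (Unit⇒1≤ (∈H⇒Unit y∈H))

      square-p≡2 : IsSquareInH
      square-p≡2 = 1 , 1∈H , ≋-reflexive (cong +_ (sym (∈H⇒≡1 b∈H)))

    residue⇒sgn≡1 : IsPowerResidue (2 ℕ.* n) a p → sgn H φ ≡ + 1
    residue⇒sgn≡1 residue =
      [ (λ p≡2 → cong ((- + 1) ^_) (inversions-constant H φ (∈H⇒≡1 p≡2)))
      , (λ p≢2 → -1^≋⇒≡ p≢2 (inversions H φ) (inj₁ refl)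
                   (≋-trans sign≋b^E (square⇒b^E≋1 (power⇒square residue)))) ]′
      (toSum (p ℕP.≟ 2))

    nonresidue⇒sgn≡-1 : ¬ IsPowerResidue (2 ℕ.* n) a p → sgn H φ ≡ - + 1
    nonresidue⇒sgn≡-1 nonresidue =
      [ (λ p≡2 → ⊥-elim (nonresidue (square⇒power (square-p≡2 p≡2))))
      , (λ p≢2 → -1^≋⇒≡ p≢2 (inversions H φ) (inj₂ refl)
                   (≋-trans sign≋b^E (nonsquare⇒b^E≋-1 p≢2 (nonresidue ∘ square⇒power)))) ]′
      (toSum (p ℕP.≟ 2))

open EulerCriterion using (module PowerResidueSign)
open import Data.Nat.Properties using (m^n>0)

open import Defs
open import Data.Nat using (ℕ; zero; suc; _^_; _∸_; _≤_; NonZero; >-nonZero)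
open import Data.Nat.Primality using (Prime; prime⇒nonZero)
open import Data.Integer using (ℤ; +_; -_)
open import Data.Integer.Divisibility using (_∣_)
open import Data.List.Membership.Propositional using (_∈_)
open import Data.Product using (_×_; ∃; _,_)
open import Relation.Binary.PropositionalEquality using (_≡_)
open import Relation.Nullary using (¬_)

theorem5 : (k p : ℕ) (a : ℤ) → 1 ≤ k → (pr : Prime p) → ¬ ((+ p) ∣ a) →
    IsPowerResidue (2 ^ (k ∸ 1)) a p →
    let H = PowSubgroup (2 ^ (k ∸ 1)) p {{prime⇒nonZero pr}}
        φ = mulMap a p {{prime⇒nonZero pr}}
    in ((∀ x → x ∈ H → φ x ∈ H)
        × (∀ x y → x ∈ H → y ∈ H → φ x ≡ φ y → x ≡ y)
        × (∀ y → y ∈ H → ∃ λ x → x ∈ H × φ x ≡ y))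
       × (IsPowerResidue (2 ^ k) a p → sgn H φ ≡ + 1)
       × (¬ IsPowerResidue (2 ^ k) a p → sgn H φ ≡ - (+ 1))
theorem5 zero p a () pr p∤a a-power
theorem5 (suc k) p a _ pr p∤a a-power =
  (φ-∈H , φ-injective , φ-surjective) , residue⇒sgn≡1 , nonresidue⇒sgn≡-1
  where
  instance
    2^k-nonZero : NonZero (2 ^ k)
    2^k-nonZero = >-nonZero (m^n>0 2 k)
  open PowerResidueSign p pr (2 ^ k) a p∤a a-power
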